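{- Let $(A,X,\perp)$ be an RS-polarity and $R_1,R_2\subseteq A\times X$ relations such that for $i\in\{1,2\}$: (1) $\forall x\in X$, $(R_i^{ -1}[x])^{\uparrow\downarrow}\subseteq R_i^{ -1}[x]$; (2) $\forall a\in A$, $(R_i[a])^{\downarrow\uparrow}\subseteq R_i[a]$; (3) $R_i\subseteq\ \perp$; (4) $\forall a\in A\,\forall x\in X\,(aR_ix\Rightarrow (R_i^{ -1}[x])^{\uparrow}\subseteq R_i[a])$. Let $\mathbb P^+$ be the complete lattice of Galois-stable subsets of $A$, and for $U\in\mathbb P^+$ let $\Box_i U=\bigcap\{R_i^{ -1}[x]\mid x\in X,\ U\subseteq x^{\downarrow}\}$. Let $S$ be the set of all composite maps $\mathbb P^+\to\mathbb P^+$ of the form $(\Box_i\Box_j)^n$ or $\Box_i(\Box_j\Box_i)^n$ with $\{i,j\}=\{1,2\}$ and $n\in\mathbb N$, and define $C(u)=\bigwedge_{s\in S}s(u)$ (meet in $\mathbb P^+$, i.e. intersection). Then for every $u\in\mathbb P^+$: $C(u)\leq u$ and $C(u)\leq C(C(u))$.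
   Context: A polarity is a triple $(A,X,\perp)$ with $A,X$ sets and $\perp\subseteq A\times X$. For $U\subseteq A$ let $U^{\uparrow}=\{x\in X\mid \forall a\in U,\ a\perp x\}$ and for $V\subseteq X$ let $V^{\downarrow}=\{a\in A\mid \forall x\in V,\ a\perp x\}$; write $U^{\uparrow\downarrow}=(U^{\uparrow})^{\downarrow}$, $V^{\downarrow\uparrow}=(V^{\downarrow})^{\uparrow}$, $a^{\uparrow}=\{a\}^{\uparrow}$, $x^{\downarrow}=\{x\}^{\downarrow}$. $U\subseteq A$ is Galois-stable if $U^{\uparrow\downarrow}=U$; these sets, ordered by inclusion, form a complete lattice $\mathbb P^+$ with meet given by intersection. Specialization preorders: for $x,y\in X$, $x\leq y$ iff $\forall a\,(a\perp x\Rightarrow a\perp y)$; for $a,b\in A$, $a\leq b$ iff $\forall x\,(b\perp x\Rightarrow a\perp x)$. RS-polarity: separating, i.e. (s1) $a\neq b\Rightarrow a^{\uparrow}\neq b^{\uparrow}$ and (s2) $x\neq y\Rightarrow x^{\downarrow}\neq y^{\downarrow}$; and reduced, i.e. (r1) for every $a\in A$ some $x\in X$ has $a$ $\leq$-minimal in $\{b\in A\mid b\not\perp x\}$, (r2) for every $x\in X$ some $a\in A$ has $x$ $\leq$-maximal in $\{y\in X\mid a\not\perp y\}$. $R^{ -1}[x]=\{a\mid aRx\}$, $R[a]=\{x\mid aRx\}$. $(\cdot)^0$ denotes the identity map. -}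

module Defs where

open import Data.Nat using (ℕ; zero; suc)
open import Data.Bool using (Bool; true; false; not)
open import Data.Product using (Σ; ∃; _×_; _,_)
open import Relation.Nullary using (¬_)
open import Relation.Binary.PropositionalEquality using (_≡_; _≢_)
open import Relation.Unary using (Pred; _⊆_; _∈_; _∉_)
open import Function.Bundles using (_⇔_)
open import Level using (0ℓ)

Rel : Set → Set → Set₁
Rel A X = A → X → Set

module _ {A X : Set} (⊥ : Rel A X) where

  _↑ : Pred A 0ℓ → Pred X 0ℓ
  (U ↑) x = ∀ a → U a → ⊥ a x

  _↓ : Pred X 0ℓ → Pred A 0ℓ
  (V ↓) a = ∀ x → V x → ⊥ a x

  pt↑ : A → Pred X 0ℓ
  pt↑ a x = ⊥ a x

  pt↓ : X → Pred A 0ℓ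
  pt↓ x a = ⊥ a x

  GaloisStable : Pred A 0ℓ → Set
  GaloisStable U = ((U ↑) ↓) ⊆ U × U ⊆ ((U ↑) ↓)

  _≤X_ : X → X → Set
  x ≤X y = ∀ a → ⊥ a x → ⊥ a y

  _≤A_ : A → A → Set
  a ≤A b = ∀ x → ⊥ b x → ⊥ a x

  Separating : Set
  Separating =
    (∀ a b → a ≢ b → ¬ (∀ x → ⊥ a x ⇔ ⊥ b x)) ×
    (∀ x y → x ≢ y → ¬ (∀ a → ⊥ a x ⇔ ⊥ a y))

  Reduced : Set
  Reduced =
    (∀ a → ∃ λ x → ¬ ⊥ a x × (∀ b → ¬ ⊥ b x → b ≤A a → a ≤A b)) ×
    (∀ x → ∃ λ a → ¬ ⊥ a x × (∀ y → ¬ ⊥ a y → x ≤X y → y ≤X x))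

  RSPolarity : Set
  RSPolarity = Separating × Reduced

  R⁻¹[_] : Rel A X → X → Pred A 0ℓ
  R⁻¹[ R ] x a = R a x

  R[_] : Rel A X → A → Pred X 0ℓ
  R[ R ] a x = R a x

  Conditions : Rel A X → Set
  Conditions R =
    (∀ x → (((R⁻¹[ R ] x) ↑) ↓) ⊆ R⁻¹[ R ] x) ×
    (∀ a → (((R[ R ] a) ↓) ↑) ⊆ R[ R ] a) ×
    (∀ a x → R a x → ⊥ a x) ×
    (∀ a x → R a x → ((R⁻¹[ R ] x) ↑) ⊆ R[ R ] a)

  □ : Rel A X → Pred A 0ℓ → Pred A 0ℓ
  □ R U a = ∀ x → U ⊆ pt↓ x → R a x

  iter : ℕ → (Pred A 0ℓ → Pred A 0ℓ) → Pred A 0ℓ → Pred A 0ℓ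
  iter zero    f u = u
  iter (suc n) f u = f (iter n f u)

  data Shape : Set where
    even odd : Shape

  module _ (R₁ R₂ : Rel A X) where
    □[_] : Bool → Pred A 0ℓ → Pred A 0ℓ
    □[ true ]  = □ R₁
    □[ false ] = □ R₂

    sMap : Bool → Shape → ℕ → Pred A 0ℓ → Pred A 0ℓ
    sMap i even n u = iter n (λ v → □[ i ] (□[ not i ] v)) u
    sMap i odd  n u = □[ i ] (iter n (λ v → □[ not i ] (□[ i ] v)) u)

    C : Pred A 0ℓ → Pred A 0ℓ
    C u a = ∀ i sh n → sMap i sh n u a

module Submission where

-- A relation R satisfying conditions (1), (2) and (4) makes
-- □_R an operator with four properties (record IsBox): it is monotone, its values
-- are closed (U↑↓ ⊆ U), it satisfies the axiom 4 inclusion □U ⊆ □□U, and it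
-- preserves intersections of closed families.
--
-- For any two such operators F true, F false we study the alternating composites
-- alt i m = F i ∘ F (not i) ∘ ⋯ (m factors).  By axiom 4 a repeated letter can be
-- dropped, so F b applied after an alternating composite, and hence any composite
-- of two alternating composites, lies above an alternating composite.  Writing
-- Alt v for the intersection of all alt i m v, this together with preservation of
-- meets gives Alt v ⊆ Alt (Alt v) for closed v.
--
-- Finally the maps of S are exactly the alternating composites of □₁, □₂ (shape
-- even of length 2n, shape odd of length 2n+1), so C = Alt, and the theorem
-- follows: C u ⊆ u is the instance s = identity, and C u ⊆ C (C u) is the
-- idempotence of Alt.

open import Defs
open import Data.Bool using (Bool; true; false; not)
open import Data.Nat using (ℕ; zero; suc)
open import Data.Product using (Σ; _×_; _,_)
open import Relation.Binary.PropositionalEquality using (_≡_; refl; cong; sym; subst)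
open import Relation.Unary using (Pred; _⊆_)
open import Level using (0ℓ)

module _ {A X : Set} (⊥ : Rel A X) where

  -- Closedness on either side of the polarity: the nontrivial half of Galois-stability.
  Closed : Pred A 0ℓ → Set
  Closed U = _↓ ⊥ (_↑ ⊥ U) ⊆ U

  Closedˣ : Pred X 0ℓ → Set
  Closedˣ V = _↑ ⊥ (_↓ ⊥ V) ⊆ V

  ⋂ : {I : Set} → (I → Pred A 0ℓ) → Pred A 0ℓ
  ⋂ G a = ∀ k → G k a

  record IsBox (F : Pred A 0ℓ → Pred A 0ℓ) : Set₁ where
    field
      mono   : ∀ {U V} → U ⊆ V → F U ⊆ F V
      closed : ∀ U → Closed (F U)
      axiom4 : ∀ U → F U ⊆ F (F U)
      meet   : {I : Set} (G : I → Pred A 0ℓ) → (∀ k → Closed (G k)) →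
               ⋂ (λ k → F (G k)) ⊆ F (⋂ G)

  module _ (R : Rel A X) where

    □-mono : ∀ {U V} → U ⊆ V → □ ⊥ R U ⊆ □ ⊥ R V
    □-mono U⊆V a∈□U x V⊆x↓ = a∈□U x (λ b∈U → V⊆x↓ (U⊆V b∈U))

    -- □U is an intersection of the sets R⁻¹[x], closed by condition (1).
    □-closed : (∀ x → Closed (λ a → R a x)) → ∀ U → Closed (□ ⊥ R U)
    □-closed cond1 U b∈□U↑↓ x U⊆x↓ =
      cond1 x (λ z z∈R⁻¹[x]↑ → b∈□U↑↓ z (λ c c∈□U → z∈R⁻¹[x]↑ c (c∈□U x U⊆x↓)))

    -- To show a R y it suffices, by condition (2), that y ⊥ every b ∈ R[a]↓.
    -- Such b lies in □U: for U ⊆ x↓ we have a R x, so R⁻¹[x]↑ ⊆ R[a] by (4),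
    -- whence b ∈ R⁻¹[x]↑↓ ⊆ R⁻¹[x] by (1).
    □-axiom4 : (∀ x → Closed (λ a → R a x)) → (∀ a → Closedˣ (λ x → R a x)) →
               (∀ a x → R a x → _↑ ⊥ (λ c → R c x) ⊆ (λ z → R a z)) →
               ∀ U → □ ⊥ R U ⊆ □ ⊥ R (□ ⊥ R U)
    □-axiom4 cond1 cond2 cond4 U {a} a∈□U y □U⊆y↓ =
      cond2 a (λ b b∈R[a]↓ → □U⊆y↓ (λ x U⊆x↓ →
        cond1 x (λ z z∈R⁻¹[x]↑ → b∈R[a]↓ z (cond4 a x (a∈□U x U⊆x↓) z∈R⁻¹[x]↑))))

    -- If a ∈ □(G k) for all k and ⋂G ⊆ y↓, then every b ∈ R[a]↓ is in each
    -- (G k)↑↓ = G k, hence b ⊥ y; so a R y by condition (2).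
    □-meet : (∀ a → Closedˣ (λ x → R a x)) →
             {I : Set} (G : I → Pred A 0ℓ) → (∀ k → Closed (G k)) →
             ⋂ (λ k → □ ⊥ R (G k)) ⊆ □ ⊥ R (⋂ G)
    □-meet cond2 G G-closed {a} a∈□G y ⋂G⊆y↓ =
      cond2 a (λ b b∈R[a]↓ → ⋂G⊆y↓ (λ k →
        G-closed k (λ z G⊆z↓ → b∈R[a]↓ z (a∈□G k z (λ c∈G → G⊆z↓ _ c∈G)))))

    □-isBox : Conditions ⊥ R → IsBox (□ ⊥ R)
    □-isBox (cond1 , cond2 , _ , cond4) = record
      { mono   = □-mono
      ; closed = □-closed cond1
      ; axiom4 = □-axiom4 cond1 cond2 cond4
      ; meet   = □-meet cond2
      }

  module Alternating (F : Bool → Pred A 0ℓ → Pred A 0ℓ) (isBox : ∀ b → IsBox (F b)) where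

    module B (b : Bool) = IsBox (isBox b)

    alt : Bool → ℕ → Pred A 0ℓ → Pred A 0ℓ
    alt i zero    v = v
    alt i (suc m) v = F i (alt (not i) m v)

    Word : Set
    Word = Bool × ℕ

    ⟦_⟧ : Word → Pred A 0ℓ → Pred A 0ℓ
    ⟦ i , m ⟧ = alt i m

    Alt : Pred A 0ℓ → Pred A 0ℓ
    Alt v = ⋂ (λ w → ⟦ w ⟧ v)

    alt-mono : ∀ i m {U V} → U ⊆ V → alt i m U ⊆ alt i m V
    alt-mono i zero    U⊆V = U⊆V
    alt-mono i (suc m) U⊆V = B.mono i (alt-mono (not i) m U⊆V)

    alt-closed : ∀ i m {v} → Closed v → Closed (alt i m v)
    alt-closed i zero    v-closed = v-closed
    alt-closed i (suc m) _        = B.closed i _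

    alt-meet : ∀ i m {I : Set} (G : I → Pred A 0ℓ) → (∀ k → Closed (G k)) →
               ⋂ (λ k → alt i m (G k)) ⊆ alt i m (⋂ G)
    alt-meet i zero    G G-closed a∈⋂ = a∈⋂
    alt-meet i (suc m) G G-closed a∈⋂ =
      B.mono i (alt-meet (not i) m G G-closed)
        (B.meet i (λ k → alt (not i) m (G k)) (λ k → alt-closed (not i) m (G-closed k)) a∈⋂)

    -- F b after an alternating composite lies above an alternating composite:
    -- either the letters alternate already, or F b F b ⊇ F b by axiom 4.
    prepend : ∀ b w v → Σ Word λ w′ → ⟦ w′ ⟧ v ⊆ F b (⟦ w ⟧ v)
    prepend b     (i     , zero)  v = (b , 1) , λ a∈ → a∈
    prepend true  (true  , suc m) v = (true , suc m) , B.axiom4 true _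
    prepend false (false , suc m) v = (false , suc m) , B.axiom4 false _
    prepend true  (false , suc m) v = (true , suc (suc m)) , λ a∈ → a∈
    prepend false (true  , suc m) v = (false , suc (suc m)) , λ a∈ → a∈

    -- A composite of two alternating composites lies above an alternating one,
    -- by prepending the letters of the outer word one at a time.
    compose : ∀ i m w v → Σ Word λ w′ → ⟦ w′ ⟧ v ⊆ alt i m (⟦ w ⟧ v)
    compose i zero    w v = w , λ a∈ → a∈
    compose i (suc m) w v with compose (not i) m w v
    ... | w′ , w′⊆inner with prepend i w′ v
    ...   | w″ , w″⊆F = w″ , λ a∈ → B.mono i w′⊆inner (w″⊆F a∈)

    Alt-mono : ∀ {U V} → U ⊆ V → Alt U ⊆ Alt V
    Alt-mono U⊆V a∈Alt (i , m) = alt-mono i m U⊆V (a∈Alt (i , m))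

    -- Idempotence of Alt: each alt i m commutes with the intersection Alt v,
    -- and alt i m (⟦ w ⟧ v) contains Alt v by compose.
    Alt-idem : ∀ {v} → Closed v → Alt v ⊆ Alt (Alt v)
    Alt-idem {v} v-closed {a} a∈Alt (i , m) =
      alt-meet i m (λ w → ⟦ w ⟧ v) (λ (j , k) → alt-closed j k v-closed) inAll
      where
      inAll : ∀ w → alt i m (⟦ w ⟧ v) a
      inAll w with compose i m w v
      ... | w′ , w′⊆ = w′⊆ (a∈Alt w′)

  module TwoBoxes (R₁ R₂ : Rel A X) (cond₁ : Conditions ⊥ R₁) (cond₂ : Conditions ⊥ R₂) where

    □ᵢ-isBox : ∀ b → IsBox (□[_] ⊥ R₁ R₂ b)
    □ᵢ-isBox true  = □-isBox R₁ cond₁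
    □ᵢ-isBox false = □-isBox R₂ cond₂

    open Alternating (□[_] ⊥ R₁ R₂) □ᵢ-isBox public

    -- double n = 2n, by a recursion matching the unfolding of (□ᵢ □ⱼ)^n.
    double : ℕ → ℕ
    double zero    = zero
    double (suc n) = suc (suc (double n))

    length : Shape ⊥ → ℕ → ℕ
    length even n = double n
    length odd  n = suc (double n)

    length-onto : ∀ m → Σ (Shape ⊥ × ℕ) λ (sh , n) → length sh n ≡ m
    length-onto zero = (even , zero) , refl
    length-onto (suc m) with length-onto m
    ... | (even , n) , refl = (odd , n) , refl
    ... | (odd  , n) , refl = (even , suc n) , refl

    sMap-even : ∀ i n v → sMap ⊥ R₁ R₂ i even n v ≡ alt i (double n) v
    sMap-even true  zero    v = refl
    sMap-even false zero    v = refl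
    sMap-even true  (suc n) v = cong (λ w → □ ⊥ R₁ (□ ⊥ R₂ w)) (sMap-even true n v)
    sMap-even false (suc n) v = cong (λ w → □ ⊥ R₂ (□ ⊥ R₁ w)) (sMap-even false n v)

    sMap-alt : ∀ i sh n v → sMap ⊥ R₁ R₂ i sh n v ≡ alt i (length sh n) v
    sMap-alt i     even n v = sMap-even i n v
    sMap-alt true  odd  n v = cong (□ ⊥ R₁) (sMap-even false n v)
    sMap-alt false odd  n v = cong (□ ⊥ R₂) (sMap-even true n v)

    C⊆Alt : ∀ v → C ⊥ R₁ R₂ v ⊆ Alt v
    C⊆Alt v {a} a∈C (i , m) with length-onto m
    ... | (sh , n) , refl = subst (λ P → P a) (sMap-alt i sh n v) (a∈C i sh n)

    Alt⊆C : ∀ v → Alt v ⊆ C ⊥ R₁ R₂ v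
    Alt⊆C v {a} a∈Alt i sh n =
      subst (λ P → P a) (sym (sMap-alt i sh n v)) (a∈Alt (i , length sh n))

-- C u ⊆ u is the component of the identity map (□_1 □_2)^0; the second claim is
-- Alt u ⊆ Alt (Alt u) transported along C = Alt.
mainTheorem4 : {A X : Set} (⊥ : Rel A X) → RSPolarity ⊥ →
    (R₁ R₂ : Rel A X) → Conditions ⊥ R₁ → Conditions ⊥ R₂ →
    (u : Pred A 0ℓ) → GaloisStable ⊥ u →
    C ⊥ R₁ R₂ u ⊆ u × C ⊥ R₁ R₂ u ⊆ C ⊥ R₁ R₂ (C ⊥ R₁ R₂ u)
mainTheorem4 ⊥ _ R₁ R₂ cond₁ cond₂ u (u-closed , _) =
  (λ a∈C → a∈C true even zero) ,
  λ a∈C → Alt⊆C (C ⊥ R₁ R₂ u)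
            (Alt-mono (Alt⊆C u) (Alt-idem u-closed (C⊆Alt u a∈C)))
  where
  open TwoBoxes ⊥ R₁ R₂ cond₁ cond₂
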